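{- The maps $h_1:R\mapsto\omega_{X_3(0)}$ and $h_2:R\mapsto\omega_{X_3(\infty)}$, defined on the set $\{\widetilde{U},\widetilde{V}\}^{\mathbb{N}^*}$ of infinite sequences $R=R_1R_2\cdots$, are injective. In particular there are uncountably many infinite words $\omega_{X_3(0)}$ and uncountably many infinite words $\omega_{X_3(\infty)}$.
   Context: Words over $\{a,b\}$ are identified with words over $\{1,2\}$ via $a\mapsto22$, $b\mapsto11$; $w^T$ is the reversal of a finite word $w$. $\widetilde{U}(\alpha,\beta)=(\alpha\beta\beta,\alpha\beta\beta\beta)$ and $\widetilde{V}(\alpha,\beta)=(\alpha\beta\beta\beta,\alpha\beta\beta\beta\beta)$. Given $R=R_1R_2\cdots$ with $R_i\in\{\widetilde{U},\widetilde{V}\}$, set $(\alpha_0,\beta_0)=(a,ab)$ and $(\alpha_n,\beta_n)=R_n(\alpha_{n-1},\beta_{n-1})$. Then $\beta_n^T$ is a prefix of $\beta_{n+1}^T$ and $\alpha_n\beta_n\beta_n$ is a prefix of $\alpha_{n+1}\beta_{n+1}\beta_{n+1}$; $\omega_{X_3(0)}$ (resp. $\omega_{X_3(\infty)}$) is the infinite word having every $\beta_n^T$ (resp. every $\alpha_n\beta_n\beta_n$) as a prefix. -}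

module Defs where

open import Data.Nat using (ℕ; zero; suc)
open import Data.List using (List; []; _∷_; _++_; reverse; concatMap)
open import Data.Product using (_×_; _,_; proj₁; proj₂)

data AB : Set where
  a b : AB

φ₁ : AB → List ℕ
φ₁ a = 2 ∷ 2 ∷ []
φ₁ b = 1 ∷ 1 ∷ []

φ : List AB → List ℕ
φ = concatMap φ₁

data Rule : Set where
  U V : Rule

Pair : Set
Pair = List AB × List AB

applyRule : Rule → Pair → Pair
applyRule U (α , β) = (α ++ β ++ β , α ++ β ++ β ++ β)
applyRule V (α , β) = (α ++ β ++ β ++ β , α ++ β ++ β ++ β ++ β)

-- A sequence R = R₁ R₂ ⋯ is represented as R : ℕ → Rule with R n = R_{n+1}.
-- pairAt R n = (α_n , β_n)
pairAt : (ℕ → Rule) → ℕ → Pair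
pairAt R zero    = (a ∷ [] , a ∷ b ∷ [])
pairAt R (suc n) = applyRule (R n) (pairAt R n)

α : (ℕ → Rule) → ℕ → List AB
α R n = proj₁ (pairAt R n)

β : (ℕ → Rule) → ℕ → List AB
β R n = proj₂ (pairAt R n)

nth : List ℕ → ℕ → ℕ
nth []       _       = 0
nth (x ∷ xs) zero    = x
nth (x ∷ xs) (suc i) = nth xs i

-- Infinite words over {1,2} are functions ℕ → ℕ (values in {1,2}).
InfWord : Set
InfWord = ℕ → ℕ

-- ω_{X₃(0)} : the infinite word having every β_n^T as prefix.
-- Its i-th letter is read off β_i^T, whose length (≥ 4 + 2i over {1,2}) exceeds i,
-- so the default of nth is never used.
ω₀ : (ℕ → Rule) → InfWord
ω₀ R i = nth (reverse (φ (β R i))) i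

-- ω_{X₃(∞)} : the infinite word having every α_n β_n β_n as prefix.
ω∞ : (ℕ → Rule) → InfWord
ω∞ R i = nth (φ (α R i ++ β R i ++ β R i)) i

-- After n substitutions there is a position d_n carrying a in α_n^T and b in β_n^T (for
-- X₃(∞): a in α_nβ_n and b in β_nα_n), and d_n only depends on R₁ ⋯ Rₙ.  The word β_{n+1}^T
-- (resp. α_{n+1}β_{n+1}β_{n+1}) begins with a block whose length is known from R₁ ⋯ Rₙ, followed
-- by α_n^T for Ũ and β_n^T for Ṽ (resp. α_nβ_n for Ũ and β_nα_n for Ṽ).  So the letter of ω at a
-- position computable from R₁ ⋯ Rₙ spells Rₙ₊₁: this gives injectivity by strong induction, and
-- choosing Rₙ₊₁ to contradict the n-th word of an enumeration gives Cantor's diagonal argument.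
module Submission where

open import Defs
open import Data.Nat using (ℕ; zero; suc; _+_; _≤_; _<_; _≤′_; ≤′-refl; ≤′-step; _≟_; z≤n; s≤s)
open import Data.Nat.Induction using (<-rec)
open import Data.Nat.Properties
  using ( ≤-total; ≤-trans; ≤-<-trans; <-≤-trans; +-suc; <⇒≢; n<1+n; m<n⇒m<1+n; m<1+n⇒m<n∨m≡n
        ; m≤m+n; m<m+n; +-monoʳ-≤; ≤⇒≤′; module ≤-Reasoning)
open import Data.List using (List; []; _∷_; _++_; [_]; length; reverse)
open import Data.List.Properties
  using ( ++-assoc; ++-identityʳ; ++-monoid; length-++; length-++-≤ˡ; length-++-≤ʳ; length-reverse
        ; reverse-++; unfold-reverse; concatMap-++)
open import Data.Maybe using (Maybe; just; nothing)
open import Data.Product using (Σ; ∃; _×_; _,_; proj₁; proj₂)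
open import Data.Sum using (inj₁; inj₂)
open import Data.Empty using (⊥-elim)
open import Function using (const)
open import Relation.Nullary using (¬_; yes; no)
open import Relation.Binary.PropositionalEquality
  using (_≡_; _≢_; refl; sym; trans; cong; cong₂; subst; subst₂; module ≡-Reasoning)
open import Tactic.MonoidSolver using (solve)

private
  variable
    A : Set
    x : A
    xs ys zs P Q : List A
    d m n p q : ℕ
    R R′ : ℕ → Rule

infixl 5 _‼_
_‼_ : List A → ℕ → Maybe A
[]       ‼ _     = nothing
(y ∷ ys) ‼ zero  = just y
(y ∷ ys) ‼ suc i = ys ‼ i

‼-++ˡ : ∀ (xs : List A) ys → xs ‼ p ≡ just x → (xs ++ ys) ‼ p ≡ just x
‼-++ˡ {p = zero}  (y ∷ xs) ys e = e
‼-++ˡ {p = suc p} (y ∷ xs) ys e = ‼-++ˡ xs ys e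

‼-++ʳ : ∀ (xs : List A) ys p → (xs ++ ys) ‼ (length xs + p) ≡ ys ‼ p
‼-++ʳ []       ys p = refl
‼-++ʳ (x ∷ xs) ys p = ‼-++ʳ xs ys p

‼-++ˡ⁻ : ∀ (xs : List A) ys → p < length xs → (xs ++ ys) ‼ p ≡ just x → xs ‼ p ≡ just x
‼-++ˡ⁻ {p = zero}  (y ∷ xs) ys _       e = e
‼-++ˡ⁻ {p = suc p} (y ∷ xs) ys (s≤s q) e = ‼-++ˡ⁻ xs ys q e

infix 4 _⊑_
_⊑_ : List A → List A → Set
xs ⊑ ys = Σ _ λ zs → xs ++ zs ≡ ys

⊑-refl : xs ⊑ xs
⊑-refl {xs = xs} = [] , ++-identityʳ xs

⊑-trans : xs ⊑ ys → ys ⊑ zs → xs ⊑ zs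
⊑-trans {xs = xs} (us , refl) (vs , refl) = us ++ vs , sym (++-assoc xs us vs)

⊑-reflexive : xs ≡ ys → xs ⊑ ys
⊑-reflexive refl = ⊑-refl

‼-⊑ : xs ⊑ ys → xs ‼ p ≡ just x → ys ‼ p ≡ just x
‼-⊑ {xs = xs} (zs , refl) = ‼-++ˡ xs zs

‼-⊑⁻ : xs ⊑ ys → p < length xs → ys ‼ p ≡ just x → xs ‼ p ≡ just x
‼-⊑⁻ {xs = xs} (zs , refl) = ‼-++ˡ⁻ xs zs

⊑-chain : (W : ℕ → List A) → (∀ n → W n ⊑ W (suc n)) → m ≤′ n → W m ⊑ W n
⊑-chain W step ≤′-refl       = ⊑-refl
⊑-chain W step (≤′-step m≤n) = ⊑-trans (⊑-chain W step m≤n) (step _)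

‼-stable : (W : ℕ → List A) → (∀ n → W n ⊑ W (suc n)) → (∀ n → n < length (W n)) →
           W m ‼ p ≡ just x → p ≤ q → W q ‼ p ≡ just x
‼-stable {m = m} {p = p} {q = q} W step long e p≤q with ≤-total m q
... | inj₁ m≤q = ‼-⊑ (⊑-chain W step (≤⇒≤′ m≤q)) e
... | inj₂ q≤m = ‼-⊑⁻ (⊑-chain W step (≤⇒≤′ q≤m)) (≤-<-trans p≤q (long q)) e

letterCode : AB → ℕ
letterCode a = 2
letterCode b = 1

nth-φ : ∀ w → w ‼ p ≡ just x → nth (φ w) (p + p) ≡ letterCode x
nth-φ {p = zero}  (a ∷ w) refl = refl
nth-φ {p = zero}  (b ∷ w) refl = refl
nth-φ {p = suc p} (a ∷ w) e rewrite +-suc p p = nth-φ w e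
nth-φ {p = suc p} (b ∷ w) e rewrite +-suc p p = nth-φ w e

reverse-φ : ∀ w → reverse (φ w) ≡ φ (reverse w)
reverse-φ []      = refl
reverse-φ (x ∷ w) = begin
  reverse (φ₁ x ++ φ w)           ≡⟨ reverse-++ (φ₁ x) (φ w) ⟩
  reverse (φ w) ++ reverse (φ₁ x) ≡⟨ cong₂ _++_ (reverse-φ w) (reverse-φ₁ x) ⟩
  φ (reverse w) ++ φ [ x ]        ≡⟨ concatMap-++ φ₁ (reverse w) [ x ] ⟨
  φ (reverse w ++ [ x ])          ≡⟨ cong φ (unfold-reverse x w) ⟨
  φ (reverse (x ∷ w))             ∎
  where
  open ≡-Reasoning
  reverse-φ₁ : ∀ x → reverse (φ₁ x) ≡ φ [ x ]
  reverse-φ₁ a = refl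
  reverse-φ₁ b = refl

ruleLetter : Rule → AB
ruleLetter U = a
ruleLetter V = b

ruleCode : Rule → ℕ
ruleCode r = letterCode (ruleLetter r)

ruleCode-injective : ∀ {r s} → ruleCode r ≡ ruleCode s → r ≡ s
ruleCode-injective {U} {U} _ = refl
ruleCode-injective {V} {V} _ = refl

avoiding : ℕ → Rule
avoiding v with v ≟ 2
... | yes _ = V
... | no  _ = U

ruleCode-avoiding : ∀ v → ruleCode (avoiding v) ≢ v
ruleCode-avoiding v with v ≟ 2
... | yes refl = λ ()
... | no  v≢2  = λ 2≡v → v≢2 (sym 2≡v)

AgreeBelow : ℕ → (ℕ → Rule) → (ℕ → Rule) → Set
AgreeBelow n R R′ = ∀ {m} → m < n → R m ≡ R′ m

AgreeBelow-pred : AgreeBelow (suc n) R R′ → AgreeBelow n R R′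
AgreeBelow-pred agree m<n = agree (m<n⇒m<1+n m<n)

pairAt-causal : AgreeBelow n R R′ → pairAt R n ≡ pairAt R′ n
pairAt-causal {zero}  agree = refl
pairAt-causal {suc n} agree = cong₂ applyRule (agree (n<1+n n)) (pairAt-causal (AgreeBelow-pred agree))

offset : (Rule → Pair → ℕ) → ℕ → (ℕ → Rule) → ℕ → ℕ
offset δ d₀ R zero    = d₀
offset δ d₀ R (suc n) = δ (R n) (pairAt R n) + offset δ d₀ R n

offset-causal : ∀ δ d₀ → AgreeBelow n R R′ → offset δ d₀ R n ≡ offset δ d₀ R′ n
offset-causal {zero}  δ d₀ agree = refl
offset-causal {suc n} δ d₀ agree =
  cong₂ _+_ (cong₂ δ (agree (n<1+n n)) (pairAt-causal agree′)) (offset-causal δ d₀ agree′)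
  where agree′ = AgreeBelow-pred agree

update : ℕ → A → (ℕ → A) → ℕ → A
update n x f m with m ≟ n
... | yes _ = x
... | no  _ = f m

update-≡ : ∀ n (f : ℕ → A) → update n x f n ≡ x
update-≡ n f with n ≟ n
... | yes _  = refl
... | no n≢n = ⊥-elim (n≢n refl)

update-≢ : ∀ (f : ℕ → A) → m ≢ n → update n x f m ≡ f m
update-≢ {m = m} {n = n} f m≢n with m ≟ n
... | yes m≡n = ⊥-elim (m≢n m≡n)
... | no  _   = refl

-- Reading a sequence of rules off an infinite word

module Readout
  (W : (ℕ → Rule) → ℕ → List AB)
  (W-⊑ : ∀ R n → W R n ⊑ W R (suc n))
  (W-long : ∀ R n → n < length (W R n))
  (pos : (ℕ → Rule) → ℕ → ℕ)
  (pos-causal : ∀ {n R R′} → AgreeBelow n R R′ → pos R n ≡ pos R′ n)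
  (W-pos : ∀ R n → W R (suc n) ‼ pos R n ≡ just (ruleLetter (R n)))
  (ω : (ℕ → Rule) → InfWord)
  (ω-W : ∀ R i → ω R i ≡ nth (φ (W R i)) i)
  where

  readAt : (ℕ → Rule) → ℕ → ℕ
  readAt R n = pos R n + pos R n

  ω-readAt : ∀ R n → ω R (readAt R n) ≡ ruleCode (R n)
  ω-readAt R n = trans (ω-W R _) (nth-φ (W R (readAt R n))
    (‼-stable (W R) (W-⊑ R) (W-long R) (W-pos R n) (m≤m+n (pos R n) (pos R n))))

  ω-injective : ∀ R R′ → (∀ i → ω R i ≡ ω R′ i) → ∀ n → R n ≡ R′ n
  ω-injective R R′ ω≡ = <-rec _ λ n agree → ruleCode-injective (begin
    ruleCode (R n)      ≡⟨ ω-readAt R n ⟨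
    ω R (readAt R n)    ≡⟨ ω≡ (readAt R n) ⟩
    ω R′ (readAt R n)   ≡⟨ cong (λ p → ω R′ (p + p)) (pos-causal agree) ⟩
    ω R′ (readAt R′ n)  ≡⟨ ω-readAt R′ n ⟩
    ruleCode (R′ n)     ∎)
    where open ≡-Reasoning

  module Diagonal (f : ℕ → InfWord) where

    approx : ℕ → ℕ → Rule
    approx zero    = const U
    approx (suc n) = update n (avoiding (f n (readAt (approx n) n))) (approx n)

    diagonal : ℕ → Rule
    diagonal n = approx (suc n) n

    diagonal-agrees : ∀ n → AgreeBelow n diagonal (approx n)
    diagonal-agrees (suc n) {m} m<1+n with m<1+n⇒m<n∨m≡n m<1+n
    ... | inj₁ m<n  = trans (diagonal-agrees n m<n) (sym (update-≢ (approx n) (<⇒≢ m<n)))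
    ... | inj₂ refl = refl

    ω-diagonal-avoids : ∀ n → ¬ (∀ i → ω diagonal i ≡ f n i)
    ω-diagonal-avoids n ω≡ = ruleCode-avoiding (f n i) (begin
      ruleCode (avoiding (f n i))     ≡⟨ cong ruleCode (update-≡ n (approx n)) ⟨
      ruleCode (diagonal n)           ≡⟨ ω-readAt diagonal n ⟨
      ω diagonal (readAt diagonal n)  ≡⟨ cong (λ p → ω diagonal (p + p)) (pos-causal (diagonal-agrees n)) ⟩
      ω diagonal i                    ≡⟨ ω≡ i ⟩
      f n i                           ∎)
      where
      open ≡-Reasoning
      i = readAt (approx n) n

  ω-uncountable : (f : ℕ → InfWord) → ∃ λ R → ∀ n → ¬ (∀ i → ω R i ≡ f n i)
  ω-uncountable f = diagonal , ω-diagonal-avoids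
    where open Diagonal f

-- Marked positions

record Marked (d : ℕ) (P Q : List AB) : Set where
  constructor marked
  field
    a-at : P ‼ d ≡ just a
    b-at : Q ‼ d ≡ just b

Marked-⊑ : P ⊑ xs → Q ⊑ ys → Marked d P Q → Marked d xs ys
Marked-⊑ P⊑ Q⊑ (marked Pa Qb) = marked (‼-⊑ P⊑ Pa) (‼-⊑ Q⊑ Qb)

Marked-++ˡ : ∀ Z → Marked d P Q → Marked (length Z + d) (Z ++ P) (Z ++ Q)
Marked-++ˡ {d = d} {P = P} {Q = Q} Z (marked Pa Qb) =
  marked (trans (‼-++ʳ Z P d) Pa) (trans (‼-++ʳ Z Q d) Qb)

select : Rule → List A → List A → List A
select U P Q = P
select V P Q = Q

Marked-select : ∀ r → Marked d P Q → select r P Q ‼ d ≡ just (ruleLetter r)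
Marked-select U = Marked.a-at
Marked-select V = Marked.b-at

‼-select : ∀ r Z → Marked d P Q → Z ++ select r P Q ⊑ xs → xs ‼ (length Z + d) ≡ just (ruleLetter r)
‼-select {d = d} {P = P} {Q = Q} r Z marks ⊑xs =
  ‼-⊑ ⊑xs (trans (‼-++ʳ Z (select r P Q) d) (Marked-select r marks))

Marked-offset : ∀ (P Q : Pair → List AB) δ d₀ → Marked d₀ (P (pairAt R 0)) (Q (pairAt R 0)) →
  (∀ r pr d → Marked d (P pr) (Q pr) → Marked (δ r pr + d) (P (applyRule r pr)) (Q (applyRule r pr))) →
  ∀ n → Marked (offset δ d₀ R n) (P (pairAt R n)) (Q (pairAt R n))
Marked-offset P Q δ d₀ base step zero    = base
Marked-offset P Q δ d₀ base step (suc n) = step _ _ _ (Marked-offset P Q δ d₀ base step n)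

block : Rule → List A → List A
block U β = β ++ β
block V β = β ++ (β ++ β)

applyRule-block : ∀ r α β → applyRule r (α , β) ≡ (α ++ block r β , α ++ (β ++ block r β))
applyRule-block U α β = refl
applyRule-block V α β = refl

block-comm : ∀ r (β : List A) → β ++ block r β ≡ block r β ++ β
block-comm U β = sym (++-assoc β β β)
block-comm {A = A} V β = solve (++-monoid A)

length-block : ∀ r (β : List A) → length β ≤ length (block r β)
length-block U β = length-++-≤ˡ β
length-block V β = length-++-≤ˡ β

length-β-step : ∀ r α β → length β + length β ≤ length (proj₂ (applyRule r (α , β)))
length-β-step r α β rewrite applyRule-block r α β = begin
  length β + length β             ≤⟨ +-monoʳ-≤ (length β) (length-block r β) ⟩
  length β + length (block r β)   ≡⟨ length-++ β ⟨
  length (β ++ block r β)         ≤⟨ length-++-≤ʳ (β ++ block r β) {α} ⟩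
  length (α ++ (β ++ block r β))  ∎
  where open ≤-Reasoning

β-long : ∀ R n → n < length (β R n)
β-long R zero    = s≤s z≤n
β-long R (suc n) = begin-strict
  suc n                            ≤⟨ β-long R n ⟩
  length (β R n)                   <⟨ m<m+n (length (β R n)) (≤-<-trans z≤n (β-long R n)) ⟩
  length (β R n) + length (β R n)  ≤⟨ length-β-step (R n) (α R n) (β R n) ⟩
  length (β R (suc n))             ∎
  where open ≤-Reasoning

-- ω_{X₃(0)}

shift₀ : Rule → Pair → ℕ
shift₀ r (α , β) = length (reverse (block r β))

αᵀ βᵀ : Pair → List AB
αᵀ (α , β) = reverse α
βᵀ (α , β) = reverse β

Marked₀-step : ∀ r pr d → Marked d (αᵀ pr) (βᵀ pr) →
               Marked (shift₀ r pr + d) (αᵀ (applyRule r pr)) (βᵀ (applyRule r pr))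
Marked₀-step r (α , β) d marks =
  subst₂ (Marked _) αᵀ′ βᵀ′ (Marked-++ˡ Z (Marked-⊑ ⊑-refl (reverse α , refl) marks))
  where
  open ≡-Reasoning
  Z = reverse (block r β)
  αᵀ′ : Z ++ reverse α ≡ αᵀ (applyRule r (α , β))
  αᵀ′ rewrite applyRule-block r α β = sym (reverse-++ α (block r β))
  βᵀ′ : Z ++ (reverse β ++ reverse α) ≡ βᵀ (applyRule r (α , β))
  βᵀ′ rewrite applyRule-block r α β = begin
    Z ++ (reverse β ++ reverse α)          ≡⟨ ++-assoc Z (reverse β) (reverse α) ⟨
    (Z ++ reverse β) ++ reverse α          ≡⟨ cong (_++ reverse α) (reverse-++ β (block r β)) ⟨
    reverse (β ++ block r β) ++ reverse α  ≡⟨ reverse-++ α (β ++ block r β) ⟨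
    reverse (α ++ (β ++ block r β))        ∎

marked₀ : ∀ R n → Marked (offset shift₀ 0 R n) (αᵀ (pairAt R n)) (βᵀ (pairAt R n))
marked₀ R = Marked-offset αᵀ βᵀ shift₀ 0 (marked refl refl) Marked₀-step

βᵀ-⊑ : ∀ r α β → reverse β ⊑ βᵀ (applyRule r (α , β))
βᵀ-⊑ r α β rewrite applyRule-block r α β = reverse (α ++ block r β) , (begin
  reverse β ++ reverse (α ++ block r β)  ≡⟨ reverse-++ (α ++ block r β) β ⟨
  reverse ((α ++ block r β) ++ β)        ≡⟨ cong reverse (++-assoc α (block r β) β) ⟩
  reverse (α ++ (block r β ++ β))        ≡⟨ cong (λ X → reverse (α ++ X)) (block-comm r β) ⟨
  reverse (α ++ (β ++ block r β))        ∎)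
  where open ≡-Reasoning

βᵀ-select : ∀ r α β →
  reverse (block V β) ++ select r (reverse α) (reverse β ++ reverse α) ≡ βᵀ (applyRule r (α , β))
βᵀ-select U α β = sym (reverse-++ α (block V β))
βᵀ-select V α β = begin
  reverse (block V β) ++ (reverse β ++ reverse α)  ≡⟨ ++-assoc (reverse (block V β)) (reverse β) (reverse α) ⟨
  (reverse (block V β) ++ reverse β) ++ reverse α  ≡⟨ cong (_++ reverse α) (reverse-++ β (block V β)) ⟨
  reverse (β ++ block V β) ++ reverse α            ≡⟨ reverse-++ α (β ++ block V β) ⟨
  reverse (α ++ (β ++ block V β))                  ∎
  where open ≡-Reasoning

pos₀ : (ℕ → Rule) → ℕ → ℕ
pos₀ R n = length (reverse (block V (β R n))) + offset shift₀ 0 R n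

module Readout₀ = Readout
  (λ R n → reverse (β R n))
  (λ R n → βᵀ-⊑ (R n) (α R n) (β R n))
  (λ R n → subst (n <_) (sym (length-reverse (β R n))) (β-long R n))
  pos₀
  (λ agree → cong₂ _+_ (cong (λ pr → length (reverse (block V (proj₂ pr)))) (pairAt-causal agree))
                       (offset-causal shift₀ 0 agree))
  (λ R n → ‼-select (R n) (reverse (block V (β R n))) (Marked-⊑ ⊑-refl (_ , refl) (marked₀ R n))
                    (⊑-reflexive (βᵀ-select (R n) (α R n) (β R n))))
  ω₀
  (λ R i → cong (λ w → nth w i) (reverse-φ (β R i)))

-- ω_{X₃(∞)}

shift∞ : Rule → Pair → ℕ
shift∞ r (α , β) = length (α ++ block r β)

αβ βα : Pair → List AB
αβ (α , β) = α ++ β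
βα (α , β) = β ++ α

Marked∞-step : ∀ r pr d → Marked d (αβ pr) (βα pr) →
               Marked (shift∞ r pr + d) (αβ (applyRule r pr)) (βα (applyRule r pr))
Marked∞-step r (α , β) d marks rewrite applyRule-block r α β =
  subst₂ (Marked _) αβ′ βα′ (Marked-++ˡ (α ++ B) (Marked-⊑ (B , refl) (B , refl) marks))
  where
  open ≡-Reasoning
  B = block r β
  αβ′ : (α ++ B) ++ ((α ++ β) ++ B) ≡ (α ++ B) ++ (α ++ (β ++ B))
  αβ′ = cong ((α ++ B) ++_) (++-assoc α β B)
  βα′ : (α ++ B) ++ ((β ++ α) ++ B) ≡ (α ++ (β ++ B)) ++ (α ++ B)
  βα′ = begin
    (α ++ B) ++ ((β ++ α) ++ B)  ≡⟨ solve (++-monoid AB) ⟩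
    (α ++ (B ++ β)) ++ (α ++ B)  ≡⟨ cong (λ X → (α ++ X) ++ (α ++ B)) (block-comm r β) ⟨
    (α ++ (β ++ B)) ++ (α ++ B)  ∎

marked∞ : ∀ R n → Marked (offset shift∞ 1 R n) (αβ (pairAt R n)) (βα (pairAt R n))
marked∞ R = Marked-offset αβ βα shift∞ 1 (marked refl refl) Marked∞-step

prefix∞ : Pair → List AB
prefix∞ (α , β) = α ++ (β ++ β)

prefix∞-⊑ : ∀ r pr → prefix∞ pr ⊑ prefix∞ (applyRule r pr)
prefix∞-⊑ U (α , β) = _ , refl
prefix∞-⊑ V (α , β) = β ++ (β′ ++ β′) , solve (++-monoid AB)
  where β′ = proj₂ (applyRule V (α , β))

prefix∞-select : ∀ r α β → prefix∞ (α , β) ++ select r (α ++ β) (β ++ α) ⊑ prefix∞ (applyRule r (α , β))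
prefix∞-select U α β = (β ++ β) ++ β′ , solve (++-monoid AB)
  where β′ = proj₂ (applyRule U (α , β))
prefix∞-select V α β = (β ++ (β ++ (β ++ β))) ++ β′ , solve (++-monoid AB)
  where β′ = proj₂ (applyRule V (α , β))

pos∞ : (ℕ → Rule) → ℕ → ℕ
pos∞ R n = length (prefix∞ (pairAt R n)) + offset shift∞ 1 R n

module Readout∞ = Readout
  (λ R n → prefix∞ (pairAt R n))
  (λ R n → prefix∞-⊑ (R n) (pairAt R n))
  (λ R n → <-≤-trans (β-long R n)
                     (≤-trans (length-++-≤ˡ (β R n)) (length-++-≤ʳ (β R n ++ β R n) {α R n})))
  pos∞
  (λ agree → cong₂ _+_ (cong (λ pr → length (prefix∞ pr)) (pairAt-causal agree))
                       (offset-causal shift∞ 1 agree))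
  (λ R n → ‼-select (R n) (prefix∞ (pairAt R n)) (marked∞ R n) (prefix∞-select (R n) (α R n) (β R n)))
  ω∞
  (λ R i → refl)

proposition3p2 : ((R R′ : ℕ → Rule) → (∀ i → ω₀ R i ≡ ω₀ R′ i) → ∀ n → R n ≡ R′ n)
    × ((R R′ : ℕ → Rule) → (∀ i → ω∞ R i ≡ ω∞ R′ i) → ∀ n → R n ≡ R′ n)
    × ((f : ℕ → InfWord) → ∃ λ (R : ℕ → Rule) → ∀ n → ¬ (∀ i → ω₀ R i ≡ f n i))
    × ((f : ℕ → InfWord) → ∃ λ (R : ℕ → Rule) → ∀ n → ¬ (∀ i → ω∞ R i ≡ f n i))
proposition3p2 =
  Readout₀.ω-injective , Readout∞.ω-injective , Readout₀.ω-uncountable , Readout∞.ω-uncountable
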